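{- Let $G$ be a connected graph. Then $\mathrm{diam}(G)\le 3$ if and only if every independent set of $G$ is a general position set of $G$.
   Context: A set of vertices is a general position set if no three distinct vertices of it lie on a common geodesic (shortest path) of $G$. $\mathrm{diam}(G)$ is the maximum distance between two vertices of $G$. -}

module Defs where

open import Level using (0ℓ)
open import Data.Nat using (ℕ; zero; suc; _≤_)
open import Data.Fin using (Fin)
open import Data.Product using (Σ; ∃; _×_; _,_)
open import Relation.Nullary using (¬_; Dec)
open import Relation.Binary.PropositionalEquality using (_≡_; _≢_)

record Graph : Set₁ where
  field
    n     : ℕ
    Adj   : Fin n → Fin n → Set
    adj?  : ∀ u v → Dec (Adj u v)
    sym   : ∀ {u v} → Adj u v → Adj v u
    irrefl : ∀ {u} → ¬ Adj u u

module _ (G : Graph) where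
  open Graph G

  V : Set
  V = Fin n

  data Walk : V → V → ℕ → Set where
    [_]  : (u : V) → Walk u u zero
    _∷_  : ∀ {u w v k} → Adj u w → Walk w v k → Walk u v (suc k)

  data _∈W_ (x : V) : ∀ {u v k} → Walk u v k → Set where
    here-end : x ∈W [ x ]
    here     : ∀ {w v k} (e : Adj x w) (p : Walk w v k) → x ∈W (e ∷ p)
    there    : ∀ {u w v k} (e : Adj u w) {p : Walk w v k} → x ∈W p → x ∈W (e ∷ p)

  DistLe : V → V → ℕ → Set
  DistLe u v k = Σ ℕ λ m → m ≤ k × Walk u v m

  Connected : Set
  Connected = ∀ u v → Σ ℕ λ k → Walk u v k

  DiamLe : ℕ → Set
  DiamLe k = ∀ u v → DistLe u v k

  IsGeodesic : ∀ {u v k} → Walk u v k → Set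
  IsGeodesic {u} {v} {k} _ = ∀ {m} → Walk u v m → k ≤ m

  Independent : (V → Set) → Set
  Independent S = ∀ u v → S u → S v → ¬ Adj u v

  GeneralPosition : (V → Set) → Set
  GeneralPosition S =
    ∀ x y z → S x → S y → S z → x ≢ y → y ≢ z → x ≢ z →
    ∀ {u v k} (P : Walk u v k) → IsGeodesic P →
    ¬ (x ∈W P × y ∈W P × z ∈W P)

-- If diam(G) ≤ 3, every geodesic has at most four vertices, and three of them
-- that are pairwise distinct and non-adjacent would need positions pairwise at
-- least two apart, i.e. a geodesic of length at least four.  Conversely, if some
-- pair were at distance four, the first, middle and last vertex of a geodesic
-- between them form an independent set that is not in general position; since
-- any walk can be shortened one edge at a time, this bounds all distances by 3.
module Submission where

open import Defs
open import Function.Bundles using (_⇔_; mk⇔)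
open import Data.Nat using (zero; suc; _≤_; _<_; z≤n; s≤s; s≤s⁻¹)
open import Data.Nat.Properties
  using (≤-refl; ≤-trans; ≤-antisym; <⇒≱; m≤n⇒m≤1+n; m≤n⇒m<n∨m≡n; ≰⇒>; _≤?_)
open import Data.Fin.Properties using (_≟_; any?)
open import Data.Product using (_×_; _,_; proj₂)
open import Data.Sum using (_⊎_; inj₁; inj₂)
open import Data.Empty using (⊥-elim)
open import Relation.Nullary using (¬_; Dec; yes; no)
open import Relation.Nullary.Decidable using (_×-dec_)
open import Relation.Binary.PropositionalEquality using (_≡_; _≢_; refl)

module _ (G : Graph) where
  open Graph G renaming (sym to adj-sym)

  IndependentSetsInGeneralPosition : Set₁
  IndependentSetsInGeneralPosition = ∀ (S : V G → Set) → Independent G S → GeneralPosition G S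

  Apart : V G → V G → Set
  Apart x y = x ≢ y × ¬ Adj x y

  Apart-sym : ∀ {x y} → Apart x y → Apart y x
  Apart-sym (x≢y , x≁y) = (λ { refl → x≢y refl }) , (λ y~x → x≁y (adj-sym y~x))

  neighbour-apart⇒nonempty : ∀ {u w y v m} → Adj u w → Apart u y →
    (p : Walk G w v m) → _∈W_ G y p → 1 ≤ m
  neighbour-apart⇒nonempty u~w (_ , u≁w) [ _ ] here-end = ⊥-elim (u≁w u~w)
  neighbour-apart⇒nonempty _ _ (_ ∷ _) _ = s≤s z≤n

  apart-on-walk⇒2≤length : ∀ {x y u v k} → Apart x y →
    (P : Walk G u v k) → _∈W_ G x P → _∈W_ G y P → 2 ≤ k
  apart-on-walk⇒2≤length (x≢y , _) _ here-end here-end = ⊥-elim (x≢y refl)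
  apart-on-walk⇒2≤length (x≢y , _) _ (here _ _) (here _ _) = ⊥-elim (x≢y refl)
  apart-on-walk⇒2≤length xy (e ∷ p) (here _ _) (there _ y∈p) =
    s≤s (neighbour-apart⇒nonempty e xy p y∈p)
  apart-on-walk⇒2≤length xy (e ∷ p) (there _ x∈p) (here _ _) =
    s≤s (neighbour-apart⇒nonempty e (Apart-sym xy) p x∈p)
  apart-on-walk⇒2≤length xy (_ ∷ p) (there _ x∈p) (there _ y∈p) =
    m≤n⇒m≤1+n (apart-on-walk⇒2≤length xy p x∈p y∈p)

  neighbour-apart-pair⇒3≤length : ∀ {u w y z v m} → Adj u w →
    Apart u y → Apart u z → Apart y z →
    (p : Walk G w v m) → _∈W_ G y p → _∈W_ G z p → 3 ≤ m
  neighbour-apart-pair⇒3≤length u~w (_ , u≁y) _ _ _ here-end _ = ⊥-elim (u≁y u~w)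
  neighbour-apart-pair⇒3≤length u~w (_ , u≁y) _ _ _ (here _ _) _ = ⊥-elim (u≁y u~w)
  neighbour-apart-pair⇒3≤length u~w _ (_ , u≁z) _ _ _ (here _ _) = ⊥-elim (u≁z u~w)
  neighbour-apart-pair⇒3≤length _ _ _ yz (_ ∷ p) (there _ y∈p) (there _ z∈p) =
    s≤s (apart-on-walk⇒2≤length yz p y∈p z∈p)

  apart-triple-on-walk⇒4≤length : ∀ {x y z u v k} →
    Apart x y → Apart y z → Apart x z → (P : Walk G u v k) →
    _∈W_ G x P → _∈W_ G y P → _∈W_ G z P → 4 ≤ k
  apart-triple-on-walk⇒4≤length (x≢y , _) _ _ _ here-end here-end _ = ⊥-elim (x≢y refl)
  apart-triple-on-walk⇒4≤length (x≢y , _) _ _ _ (here _ _) (here _ _) _ = ⊥-elim (x≢y refl)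
  apart-triple-on-walk⇒4≤length _ (y≢z , _) _ _ (there _ _) (here _ _) (here _ _) =
    ⊥-elim (y≢z refl)
  apart-triple-on-walk⇒4≤length _ _ (x≢z , _) _ (here _ _) (there _ _) (here _ _) =
    ⊥-elim (x≢z refl)
  apart-triple-on-walk⇒4≤length xy yz xz (e ∷ p) (here _ _) (there _ y∈p) (there _ z∈p) =
    s≤s (neighbour-apart-pair⇒3≤length e xy xz yz p y∈p z∈p)
  apart-triple-on-walk⇒4≤length xy yz xz (e ∷ p) (there _ x∈p) (here _ _) (there _ z∈p) =
    s≤s (neighbour-apart-pair⇒3≤length e (Apart-sym xy) yz xz p x∈p z∈p)
  apart-triple-on-walk⇒4≤length xy yz xz (e ∷ p) (there _ x∈p) (there _ y∈p) (here _ _) =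
    s≤s (neighbour-apart-pair⇒3≤length e (Apart-sym xz) (Apart-sym yz) xy p x∈p y∈p)
  apart-triple-on-walk⇒4≤length xy yz xz (_ ∷ p) (there _ x∈p) (there _ y∈p) (there _ z∈p) =
    m≤n⇒m≤1+n (apart-triple-on-walk⇒4≤length xy yz xz p x∈p y∈p z∈p)

  geodesic-length≤diam : ∀ {d u v k} → DiamLe G d →
    (P : Walk G u v k) → IsGeodesic G P → k ≤ d
  geodesic-length≤diam {u = u} {v} diam _ geo with diam u v
  ... | _ , m≤d , q = ≤-trans (geo q) m≤d

  diam≤3⇒independentSetsInGeneralPosition : DiamLe G 3 → IndependentSetsInGeneralPosition
  diam≤3⇒independentSetsInGeneralPosition diam _ ind x y z sx sy sz x≢y y≢z x≢z P geo
    (x∈P , y∈P , z∈P) =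
    <⇒≱ (apart-triple-on-walk⇒4≤length
           (x≢y , ind x y sx sy) (y≢z , ind y z sy sz) (x≢z , ind x z sx sz) P x∈P y∈P z∈P)
        (geodesic-length≤diam diam P geo)

  walk? : ∀ u v m → Dec (Walk G u v m)
  walk? u v zero with u ≟ v
  ... | yes refl = yes [ u ]
  ... | no u≢v = no λ { [ _ ] → u≢v refl }
  walk? u v (suc m) with any? (λ w → adj? u w ×-dec walk? w v m)
  ... | yes (_ , e , p) = yes (e ∷ p)
  ... | no ∄step = no λ { (e ∷ p) → ∄step (_ , e , p) }

  distLe? : ∀ u v k → Dec (DistLe G u v k)
  distLe? u v zero with walk? u v zero
  ... | yes p = yes (zero , z≤n , p)
  ... | no ¬p = no λ { (zero , _ , p) → ¬p p }
  distLe? u v (suc k) with distLe? u v k | walk? u v (suc k)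
  ... | yes (m , m≤k , p) | _ = yes (m , m≤n⇒m≤1+n m≤k , p)
  ... | no _ | yes p = yes (suc k , ≤-refl , p)
  ... | no far | no ¬p = no λ { (_ , m≤1+k , p) → shorter-or-exact (m≤n⇒m<n∨m≡n m≤1+k) p }
    where
    shorter-or-exact : ∀ {m} → m < suc k ⊎ m ≡ suc k → ¬ Walk G u v m
    shorter-or-exact (inj₁ m<1+k) p = far (_ , s≤s⁻¹ m<1+k , p)
    shorter-or-exact (inj₂ refl) p = ¬p p

  ¬distLe⇒geodesic : ∀ {u v k} → ¬ DistLe G u v k →
    (P : Walk G u v (suc k)) → IsGeodesic G P
  ¬distLe⇒geodesic {k = k} far _ {m} q with suc k ≤? m
  ... | yes 1+k≤m = 1+k≤m
  ... | no 1+k≰m = ⊥-elim (far (m , s≤s⁻¹ (≰⇒> 1+k≰m) , q))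

  Triple : V G → V G → V G → V G → Set
  Triple x y z v = v ≡ x ⊎ v ≡ y ⊎ v ≡ z

  Triple-independent : ∀ {x y z} → ¬ Adj x y → ¬ Adj y z → ¬ Adj x z →
    Independent G (Triple x y z)
  Triple-independent _ _ _ _ _ (inj₁ refl) (inj₁ refl) e = irrefl e
  Triple-independent x≁y _ _ _ _ (inj₁ refl) (inj₂ (inj₁ refl)) e = x≁y e
  Triple-independent _ _ x≁z _ _ (inj₁ refl) (inj₂ (inj₂ refl)) e = x≁z e
  Triple-independent x≁y _ _ _ _ (inj₂ (inj₁ refl)) (inj₁ refl) e = x≁y (adj-sym e)
  Triple-independent _ _ _ _ _ (inj₂ (inj₁ refl)) (inj₂ (inj₁ refl)) e = irrefl e
  Triple-independent _ y≁z _ _ _ (inj₂ (inj₁ refl)) (inj₂ (inj₂ refl)) e = y≁z e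
  Triple-independent _ _ x≁z _ _ (inj₂ (inj₂ refl)) (inj₁ refl) e = x≁z (adj-sym e)
  Triple-independent _ y≁z _ _ _ (inj₂ (inj₂ refl)) (inj₂ (inj₁ refl)) e = y≁z (adj-sym e)
  Triple-independent _ _ _ _ _ (inj₂ (inj₂ refl)) (inj₂ (inj₂ refl)) e = irrefl e

  -- Every pair among a, w₂, b that coincided or were adjacent would give a walk
  -- from a to b of length at most 3.
  distance4⇒¬independentSetsInGeneralPosition : ∀ {a b} → ¬ DistLe G a b 3 →
    Walk G a b 4 → ¬ IndependentSetsInGeneralPosition
  distance4⇒¬independentSetsInGeneralPosition {a} {b} far
    P@(e₁ ∷ (e₂ ∷ (e₃ ∷ (e₄ ∷ [ _ ])))) H =
    H (Triple a _ b) (Triple-independent a≁w₂ w₂≁b a≁b)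
      a _ b (inj₁ refl) (inj₂ (inj₁ refl)) (inj₂ (inj₂ refl))
      a≢w₂ w₂≢b a≢b P (¬distLe⇒geodesic far P)
      ( here e₁ _
      , there e₁ (there e₂ (here e₃ _))
      , there e₁ (there e₂ (there e₃ (there e₄ here-end))))
    where
    a≢w₂ : a ≢ _
    a≢w₂ refl = far (2 , s≤s (s≤s z≤n) , e₃ ∷ (e₄ ∷ [ b ]))
    w₂≢b : _ ≢ b
    w₂≢b refl = far (2 , s≤s (s≤s z≤n) , e₁ ∷ (e₂ ∷ [ b ]))
    a≢b : a ≢ b
    a≢b refl = far (0 , z≤n , [ a ])
    a≁w₂ : ¬ Adj a _
    a≁w₂ e = far (3 , ≤-refl , e ∷ (e₃ ∷ (e₄ ∷ [ b ])))
    w₂≁b : ¬ Adj _ b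
    w₂≁b e = far (3 , ≤-refl , e₁ ∷ (e₂ ∷ (e ∷ [ b ])))
    a≁b : ¬ Adj a b
    a≁b e = far (1 , s≤s z≤n , e ∷ [ b ])

  module _ (H : IndependentSetsInGeneralPosition) where

    distLe4⇒distLe3 : ∀ {a b} → DistLe G a b 4 → DistLe G a b 3
    distLe4⇒distLe3 {a} {b} (m , m≤4 , p) with m ≤? 3 | distLe? a b 3
    ... | yes m≤3 | _ = m , m≤3 , p
    ... | no _ | yes close = close
    ... | no m≰3 | no far with refl ← ≤-antisym m≤4 (≰⇒> m≰3) =
      ⊥-elim (distance4⇒¬independentSetsInGeneralPosition far p H)

    walk⇒distLe3 : ∀ {a b k} → Walk G a b k → DistLe G a b 3
    walk⇒distLe3 [ a ] = 0 , z≤n , [ a ]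
    walk⇒distLe3 (e ∷ p) with walk⇒distLe3 p
    ... | m , m≤3 , q = distLe4⇒distLe3 (suc m , s≤s m≤3 , e ∷ q)

corollary4p3 : (G : Graph) → Connected G →
    DiamLe G 3 ⇔ (∀ (S : V G → Set) → Independent G S → GeneralPosition G S)
corollary4p3 G connected = mk⇔
  (diam≤3⇒independentSetsInGeneralPosition G)
  (λ H u v → walk⇒distLe3 G H (proj₂ (connected u v)))
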